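{- Let $p,q$ be primes and $a,b$ positive integers. Consider the equation $\binom{p^a}{i}-\binom{q^b}{j}=1$, where the binomial coefficients are required to be positive, i.e. $p^a\ge i$ and $q^b\ge j$. (1) For $(i,j)=(2,1)$, i.e. $\binom{p^a}{2}-q^b=1$, the solutions are exactly $(p,q,a,b)=(2,5,2,1),(3,2,1,1),(2,3,3,3),(5,3,1,2)$. (2) For $(i,j)=(3,1)$, i.e. $\binom{p^a}{3}-q^b=1$, the solutions are exactly $(p,q,a,b)=(2,3,2,1),(3,83,2,1),(5,3,1,2)$. (3) For $(i,j)=(4,1)$, i.e. $\binom{p^a}{4}-q^b=1$, the solutions are exactly $(p,q,a,b)=(5,2,1,2),(3,5,2,3)$.
   Context: A figurate prime is a positive binomial coefficient $\binom{p^a}{i}$ with $p$ prime and $a,i\ge 1$ integers. -}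

module Defs where

open import Data.Nat using (ℕ; _+_; _^_; _≤_)
open import Data.Nat.Combinatorics using (_C_)
open import Data.Nat.Primality using (Prime)
open import Data.Product using (_×_)
open import Data.Sum using (_⊎_)
open import Relation.Binary.PropositionalEquality using (_≡_)

-- The subtraction is written additively: binom(p^a,i) = 1 + binom(q^b,j).
IsSolution : ℕ → ℕ → ℕ → ℕ → ℕ → ℕ → Set
IsSolution i j p q a b =
  Prime p × Prime q × 1 ≤ a × 1 ≤ b × i ≤ p ^ a × j ≤ q ^ b ×
  (p ^ a) C i ≡ 1 + (q ^ b) C j

Is : ℕ → ℕ → ℕ → ℕ → ℕ → ℕ → ℕ → ℕ → Set
Is p q a b p₀ q₀ a₀ b₀ = p ≡ p₀ × q ≡ q₀ × a ≡ a₀ × b ≡ b₀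

module Submission where

-- Put p^a = i + m.  As i!·binom(i+m, i) is the falling factorial
-- (i+m)···(m+1) = i! + m·B(m) with B(m) = (1 + c(m))·m + R and R = B(0) > i!,
-- the equation becomes the reduced equation  m·B(m) = i!·q^b  (record
-- Reduction).  A common prime-power factor of m and B(m) divides R, so if
-- q^(e+1) ∤ R, one of m, B(m) divides i!·q^e (lemma split), whence m ≤ i!·q^e.
--  * q ∤ R: take e = 0; as B(m) > i!, m ∣ i!, and each divisor m gives
--    concrete values of p^a and q^b, identified by uniqueness of prime powers.
--  * q ∣ R: q is a prime factor of R, m is bounded, hence so is b, and an
--    exhaustive computation lists the solutions.

open import Data.Nat
open import Data.Nat.Properties
open import Data.Nat.Combinatorics using (_C_; nC1≡n; nCk+nC[k+1]≡[n+1]C[k+1])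
open import Data.Nat.Divisibility
open import Data.Nat.Primality
open import Data.Nat.Coprimality using (Coprime; coprime-divisor)
open import Data.Nat.Tactic.RingSolver using (solve-∀)
open import Data.Product using (Σ-syntax; _×_; _,_)
open import Data.Sum using (_⊎_; inj₁; inj₂)
open import Data.Empty using (⊥; ⊥-elim)
open import Function.Bundles using (_⇔_; mk⇔)
open import Relation.Nullary using (¬_; Dec; yes; no)
open import Relation.Nullary.Decidable
  using (True; False; toWitness; toWitnessFalse; from-yes; _→-dec_; _×-dec_; _⊎-dec_)
open import Relation.Unary using (Decidable)
open import Relation.Binary.PropositionalEquality
open import Relation.Binary.Definitions using (tri<; tri≈; tri>)
open import Defs
open ≡-Reasoning

choose₂ : ∀ n → 2 * (suc n C 2) ≡ suc n * n
choose₂ zero = refl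
choose₂ (suc n) = begin
  2 * ((2 + n) C 2)               ≡⟨ cong (2 *_) (nCk+nC[k+1]≡[n+1]C[k+1] (1 + n) 1) ⟨
  2 * ((1 + n) C 1 + (1 + n) C 2) ≡⟨ *-distribˡ-+ 2 ((1 + n) C 1) _ ⟩
  2 * ((1 + n) C 1) + 2 * ((1 + n) C 2)
                                  ≡⟨ cong₂ _+_ (cong (2 *_) (nC1≡n (1 + n))) (choose₂ n) ⟩
  2 * (1 + n) + (1 + n) * n       ≡⟨ poly n ⟩
  (2 + n) * (1 + n)               ∎
  where
  poly : ∀ n → 2 * (1 + n) + (1 + n) * n ≡ (2 + n) * (1 + n)
  poly = solve-∀

choose₃ : ∀ n → 6 * ((2 + n) C 3) ≡ (2 + n) * (1 + n) * n
choose₃ zero = refl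
choose₃ (suc n) = begin
  6 * ((3 + n) C 3)               ≡⟨ cong (6 *_) (nCk+nC[k+1]≡[n+1]C[k+1] (2 + n) 2) ⟨
  6 * ((2 + n) C 2 + (2 + n) C 3) ≡⟨ *-distribˡ-+ 6 ((2 + n) C 2) _ ⟩
  6 * ((2 + n) C 2) + 6 * ((2 + n) C 3)
                                  ≡⟨ cong (_+ 6 * ((2 + n) C 3)) (*-assoc 3 2 ((2 + n) C 2)) ⟩
  3 * (2 * ((2 + n) C 2)) + 6 * ((2 + n) C 3)
                                  ≡⟨ cong₂ _+_ (cong (3 *_) (choose₂ (1 + n))) (choose₃ n) ⟩
  3 * ((2 + n) * (1 + n)) + (2 + n) * (1 + n) * n
                                  ≡⟨ poly n ⟩
  (3 + n) * (2 + n) * (1 + n)     ∎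
  where
  poly : ∀ n → 3 * ((2 + n) * (1 + n)) + (2 + n) * (1 + n) * n ≡ (3 + n) * (2 + n) * (1 + n)
  poly = solve-∀

choose₄ : ∀ n → 24 * ((3 + n) C 4) ≡ (3 + n) * (2 + n) * (1 + n) * n
choose₄ zero = refl
choose₄ (suc n) = begin
  24 * ((4 + n) C 4)               ≡⟨ cong (24 *_) (nCk+nC[k+1]≡[n+1]C[k+1] (3 + n) 3) ⟨
  24 * ((3 + n) C 3 + (3 + n) C 4) ≡⟨ *-distribˡ-+ 24 ((3 + n) C 3) _ ⟩
  24 * ((3 + n) C 3) + 24 * ((3 + n) C 4)
                                   ≡⟨ cong (_+ 24 * ((3 + n) C 4)) (*-assoc 4 6 ((3 + n) C 3)) ⟩
  4 * (6 * ((3 + n) C 3)) + 24 * ((3 + n) C 4)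
                                   ≡⟨ cong₂ _+_ (cong (4 *_) (choose₃ (1 + n))) (choose₄ n) ⟩
  4 * ((3 + n) * (2 + n) * (1 + n)) + (3 + n) * (2 + n) * (1 + n) * n
                                   ≡⟨ poly n ⟩
  (4 + n) * (3 + n) * (2 + n) * (1 + n) ∎
  where
  poly : ∀ n → 4 * ((3 + n) * (2 + n) * (1 + n)) + (3 + n) * (2 + n) * (1 + n) * n
             ≡ (4 + n) * (3 + n) * (2 + n) * (1 + n)
  poly = solve-∀

prime>1 : ∀ {q} → Prime q → 1 < q
prime>1 {q} qp = nonTrivial⇒n>1 q {{prime⇒nonTrivial qp}}

prime∣prime^⇒≡ : ∀ {q r} → Prime q → Prime r → ∀ b → r ∣ q ^ b → r ≡ q
prime∣prime^⇒≡ qp rp zero r∣1 = ⊥-elim (nonTrivial⇒≢1 {{prime⇒nonTrivial rp}} (∣1⇒≡1 r∣1))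
prime∣prime^⇒≡ {q} qp rp (suc b) r∣q^b+1 with euclidsLemma q (q ^ b) rp r∣q^b+1
... | inj₂ r∣q^b = prime∣prime^⇒≡ qp rp b r∣q^b
... | inj₁ r∣q with prime⇒irreducible qp r∣q
...   | inj₁ r≡1 = ⊥-elim (nonTrivial⇒≢1 {{prime⇒nonTrivial rp}} r≡1)
...   | inj₂ r≡q = r≡q

^-injectiveʳ : ∀ {q} → 1 < q → ∀ {b k} → q ^ b ≡ q ^ k → b ≡ k
^-injectiveʳ {q} 1<q {b} {k} eq with <-cmp b k
... | tri≈ _ b≡k _ = b≡k
... | tri< b<k _ _ = ⊥-elim (<-irrefl eq (^-monoʳ-< q 1<q b<k))
... | tri> _ _ k<b = ⊥-elim (<-irrefl (sym eq) (^-monoʳ-< q 1<q k<b))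

primePower-unique : ∀ {p r a k} → Prime p → Prime r → p ^ a ≡ r ^ suc k → p ≡ r × a ≡ suc k
primePower-unique {p} {r} {a} {k} pp rp eq =
  p≡r , ^-injectiveʳ (prime>1 pp) (trans eq (cong (_^ suc k) (sym p≡r)))
  where
  p≡r : p ≡ r
  p≡r = sym (prime∣prime^⇒≡ pp rp a (subst (r ∣_) (sym eq) (m∣m*n (r ^ k))))

not-primePower : ∀ {p n} → Prime p → ∀ a → p ^ a ≡ n → ∀ r s →
  {True (prime? r)} → {True (prime? s)} → {False (r ≟ s)} → {True (r ∣? n)} → {True (s ∣? n)} → ⊥
not-primePower {p} {n} pp a pᵃ≡n r s {r-prime} {s-prime} {r≢s} {r∣n} {s∣n} =
  toWitnessFalse r≢s (trans (base (toWitness r-prime) (toWitness r∣n))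
                            (sym (base (toWitness s-prime) (toWitness s∣n))))
  where
  base : ∀ {x} → Prime x → x ∣ n → x ≡ p
  base {x} xp x∣n = prime∣prime^⇒≡ pp xp a (subst (x ∣_) (sym pᵃ≡n) x∣n)

settle : ∀ {p q a b p₀ q₀ a₀ b₀} → Prime p → Prime q → {True (prime? p₀)} → {True (prime? q₀)} →
  p ^ a ≡ p₀ ^ suc a₀ → q ^ b ≡ q₀ ^ suc b₀ → Is p q a b p₀ q₀ (suc a₀) (suc b₀)
settle pp qp {p₀-prime} {q₀-prime} pᵃ≡ qᵇ≡
  with primePower-unique pp (toWitness p₀-prime) pᵃ≡ | primePower-unique qp (toWitness q₀-prime) qᵇ≡
... | p≡ , a≡ | q≡ , b≡ = p≡ , q≡ , a≡ , b≡

prime∤⇒coprime : ∀ {q A} → Prime q → ¬ (q ∣ A) → Coprime A q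
prime∤⇒coprime qp q∤A (d∣A , d∣q) with prime⇒irreducible qp d∣q
... | inj₁ d≡1 = d≡1
... | inj₂ refl = ⊥-elim (q∤A d∣A)

strip : ∀ {q} → Prime q → ∀ {A} K b e → A ∣ K * q ^ b → ¬ (q ^ suc e ∣ A) → A ∣ K * q ^ e
strip {q} qp K zero e A∣K _ = ∣-trans A∣K (*-monoʳ-∣ K (1∣ (q ^ e)))
strip {q} qp {A} K (suc b) e A∣Kqqᵇ q^e+1∤A with q ∣? A
... | no q∤A = strip qp K b e A∣Kqᵇ q^e+1∤A
  where
  A∣Kqᵇ : A ∣ K * q ^ b
  A∣Kqᵇ = coprime-divisor (prime∤⇒coprime qp q∤A) (subst (A ∣_) (swap K q (q ^ b)) A∣Kqqᵇ)
    where
    swap : ∀ x y z → x * (y * z) ≡ y * (x * z)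
    swap = solve-∀
strip {q} qp K (suc b) zero _ q^1∤A | yes q∣A =
  ⊥-elim (q^1∤A (subst (_∣ _) (sym (*-identityʳ q)) q∣A))
strip {q} qp K (suc b) (suc e) A∣Kqqᵇ q^e+2∤A | yes (divides A₁ refl) =
  subst (A₁ * q ∣_) (sym (shift K q (q ^ e))) (*-monoˡ-∣ q (strip qp K b e A₁∣Kqᵇ q^e+1∤A₁))
  where
  instance _ = prime⇒nonZero qp
  shift : ∀ x y z → x * (y * z) ≡ x * z * y
  shift = solve-∀
  A₁∣Kqᵇ : A₁ ∣ K * q ^ b
  A₁∣Kqᵇ = *-cancelʳ-∣ q (subst (A₁ * q ∣_) (shift K q (q ^ b)) A∣Kqqᵇ)
  q^e+1∤A₁ : ¬ (q ^ suc e ∣ A₁)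
  q^e+1∤A₁ h = q^e+2∤A (subst (_∣ A₁ * q) (*-comm (q ^ suc e) q) (*-monoˡ-∣ q h))

-- Let A·B = K·q^b with B ≡ R (mod A).  A common power of q in A and B divides
-- R, so if q^(e+1) ∤ R then one of A, B has q-part at most q^e.
split : ∀ {q} → Prime q → ∀ {A B R} C K b e → A * B ≡ K * q ^ b → B ≡ C * A + R →
  ¬ (q ^ suc e ∣ R) → A ∣ K * q ^ e ⊎ B ∣ K * q ^ e
split {q} qp {A} {B} {R} C K b e AB≡Kqᵇ B≡CA+R q^e+1∤R with q ^ suc e ∣? A
... | no q^e+1∤A = inj₁ (strip qp K b e (subst (A ∣_) AB≡Kqᵇ (m∣m*n B)) q^e+1∤A)
... | yes q^e+1∣A = inj₂ (strip qp K b e (subst (B ∣_) AB≡Kqᵇ (n∣m*n A)) q^e+1∤B)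
  where
  q^e+1∤B : ¬ (q ^ suc e ∣ B)
  q^e+1∤B q^e+1∣B =
    q^e+1∤R (∣m+n∣m⇒∣n (subst (q ^ suc e ∣_) B≡CA+R q^e+1∣B) (∣-trans q^e+1∣A (n∣m*n C)))

-- The reduced equation.  Multiplying  binom(i+m, i) = 1 + X  by K = i! turns
-- it into  m·B(m) = K·X,  where  B(m) = (1 + c(m))·m + R  and  R > K.
record Reduction (i : ℕ) : Set where
  field
    K        : ℕ
    B c      : ℕ → ℕ
    R        : ℕ
    K≢0      : NonZero K
    falling  : ∀ m → K * ((i + m) C i) ≡ K + m * B m
    division : ∀ m → B m ≡ (1 + c m) * m + R
    K<R      : K < R

module _ {i} (red : Reduction i) where
  open Reduction red

  private instance _ = K≢0

  reduced-equation : ∀ {p q a b} → IsSolution i 1 p q a b →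
    Σ[ m ∈ ℕ ] (p ^ a ≡ i + m × m * B m ≡ K * q ^ b)
  reduced-equation {p} {q} {a} {b} (_ , _ , _ , _ , i≤pᵃ , _ , binom≡) =
    m , pᵃ≡i+m , +-cancelˡ-≡ K _ _ (begin
      K + m * B m             ≡⟨ falling m ⟨
      K * ((i + m) C i)       ≡⟨ cong (λ n → K * (n C i)) pᵃ≡i+m ⟨
      K * ((p ^ a) C i)       ≡⟨ cong (K *_) binom≡ ⟩
      K * (1 + (q ^ b) C 1)   ≡⟨ cong (λ x → K * (1 + x)) (nC1≡n (q ^ b)) ⟩
      K * (1 + q ^ b)         ≡⟨ *-distribˡ-+ K 1 (q ^ b) ⟩
      K * 1 + K * q ^ b       ≡⟨ cong (_+ K * q ^ b) (*-identityʳ K) ⟩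
      K + K * q ^ b           ∎)
    where
    m : ℕ
    m = p ^ a ∸ i
    pᵃ≡i+m : p ^ a ≡ i + m
    pᵃ≡i+m = sym (m+[n∸m]≡n i≤pᵃ)

  m≤B : ∀ m → m ≤ B m
  m≤B m = ≤-trans (m≤m+n m (c m * m)) (≤-trans (m≤m+n _ R) (≤-reflexive (sym (division m))))

  R≤B : ∀ m → R ≤ B m
  R≤B m = ≤-trans (m≤n+m R _) (≤-reflexive (sym (division m)))

  -- If q ∤ R then m divides K: the alternative B(m) ∣ K is impossible as B(m) ≥ R > K.
  cofactor-divides-K : ∀ {q} m b → Prime q → m * B m ≡ K * q ^ b → ¬ (q ∣ R) → m ∣ K
  cofactor-divides-K {q} m b qp eq q∤R
    with split qp (1 + c m) K b 0 eq (division m) (λ q^1∣R → q∤R (subst (_∣ R) (*-identityʳ q) q^1∣R))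
  ... | inj₁ m∣K*1 = subst (m ∣_) (*-identityʳ K) m∣K*1
  ... | inj₂ B∣K*1 = ⊥-elim (<⇒≱ K<R (≤-trans (R≤B m) (∣⇒≤ (subst (B m ∣_) (*-identityʳ K) B∣K*1))))

  private
    Kqᵉ≢0 : ∀ {q} → Prime q → ∀ e → NonZero (K * q ^ e)
    Kqᵉ≢0 {q} qp e = m*n≢0 K (q ^ e) {{K≢0}} {{m^n≢0 q e {{prime⇒nonZero qp}}}}

  cofactor-bound : ∀ {q} m b → Prime q → ∀ e → {False (q ^ suc e ∣? R)} →
    m * B m ≡ K * q ^ b → m ≤ K * q ^ e
  cofactor-bound {q} m b qp e {q^e+1∤R} eq
    with split qp (1 + c m) K b e eq (division m) (toWitnessFalse q^e+1∤R)
  ... | inj₁ m∣Kqᵉ = ∣⇒≤ {{Kqᵉ≢0 qp e}} m∣Kqᵉ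
  ... | inj₂ B∣Kqᵉ = ≤-trans (m≤B m) (∣⇒≤ {{Kqᵉ≢0 qp e}} B∣Kqᵉ)

opaque
  falling₂ : ∀ m → 2 * ((2 + m) C 2) ≡ 2 + m * (m + 3)
  falling₂ m = trans (choose₂ (1 + m)) (expand m)
    where
    expand : ∀ m → (2 + m) * (1 + m) ≡ 2 + m * (m + 3)
    expand = solve-∀

  division₂ : ∀ m → m + 3 ≡ (1 + 0) * m + 3
  division₂ = solve-∀

  falling₃ : ∀ m → 6 * ((3 + m) C 3) ≡ 6 + m * (m * m + 6 * m + 11)
  falling₃ m = trans (choose₃ (1 + m)) (expand m)
    where
    expand : ∀ m → (3 + m) * (2 + m) * (1 + m) ≡ 6 + m * (m * m + 6 * m + 11)
    expand = solve-∀

  division₃ : ∀ m → m * m + 6 * m + 11 ≡ (1 + (m + 5)) * m + 11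
  division₃ = solve-∀

  falling₄ : ∀ m → 24 * ((4 + m) C 4) ≡ 24 + m * (m * m * m + 10 * (m * m) + 35 * m + 50)
  falling₄ m = trans (choose₄ (1 + m)) (expand m)
    where
    expand : ∀ m → (4 + m) * (3 + m) * (2 + m) * (1 + m)
                 ≡ 24 + m * (m * m * m + 10 * (m * m) + 35 * m + 50)
    expand = solve-∀

  division₄ : ∀ m → m * m * m + 10 * (m * m) + 35 * m + 50 ≡ (1 + (m * m + 10 * m + 34)) * m + 50
  division₄ = solve-∀

red₂ : Reduction 2
red₂ = record
  { K = 2 ; B = λ m → m + 3 ; c = λ _ → 0 ; R = 3 ; K≢0 = _
  ; falling = falling₂ ; division = division₂ ; K<R = from-yes (2 <? 3) }

red₃ : Reduction 3
red₃ = record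
  { K = 6 ; B = λ m → m * m + 6 * m + 11 ; c = λ m → m + 5 ; R = 11 ; K≢0 = _
  ; falling = falling₃ ; division = division₃ ; K<R = from-yes (6 <? 11) }

red₄ : Reduction 4
red₄ = record
  { K = 24 ; B = λ m → m * m * m + 10 * (m * m) + 35 * m + 50 ; c = λ m → m * m + 10 * m + 34
  ; R = 50 ; K≢0 = _ ; falling = falling₄ ; division = division₄ ; K<R = from-yes (24 <? 50) }

by-divisors : ∀ {P : ℕ → Set} (P? : Decidable P) n .{{_ : NonZero n}} →
  {True (allUpTo? (λ d → d ∣? n →-dec P? d) (suc n))} → ∀ {d} → d ∣ n → P d
by-divisors P? n {all-divisors} d∣n = toWitness all-divisors (s≤s (∣⇒≤ d∣n)) d∣n

exponent-bound : ∀ {q K b L} → 1 < q → .{{NonZero K}} → K * q ^ b < q ^ L → b < L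
exponent-bound {q} {K} {b} {L} 1<q Kqᵇ<qᴸ =
  ≰⇒> (λ L≤b → <⇒≱ Kqᵇ<qᴸ (≤-trans (^-monoʳ-≤ q {{q≢0}} L≤b) (m≤n*m (q ^ b) K)))
  where
  q≢0 : NonZero q
  q≢0 = >-nonZero (<-trans z<s 1<q)

-- All solutions (m, b) of the reduced equation  m·B(m) = K·q^b  with m ≤ N
-- satisfy Sol: as m·B(m) < q^L for m ≤ N forces b < L, it suffices to
-- check finitely many pairs, which is done by computation.
search : ∀ {i} (red : Reduction i) → let open Reduction red in
  ∀ {q} {Sol : ℕ → ℕ → Set} (Sol? : ∀ m b → Dec (Sol m b)) N L → 1 < q →
  {True (allUpTo? (λ m → m * B m <? q ^ L) (suc N))} →
  {True (allUpTo? (λ m → allUpTo? (λ b → m * B m ≟ K * q ^ b →-dec Sol? m b) L) (suc N))} →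
  ∀ m b → m ≤ N → m * B m ≡ K * q ^ b → Sol m b
search red {q} Sol? N L 1<q {small} {checked} m b m≤N eq =
  toWitness checked (s≤s m≤N) b<L eq
  where
  open Reduction red
  b<L : b < L
  b<L = exponent-bound 1<q {{K≢0}} (subst (_< q ^ L) eq (toWitness small (s≤s m≤N)))

opaque
  divisors-of-2 : ∀ {d} → d ∣ 2 → d ≡ 1 ⊎ d ≡ 2
  divisors-of-2 = by-divisors (λ d → d ≟ 1 ⊎-dec d ≟ 2) 2

  prime-divisor-of-3 : ∀ {r} → r ∣ 3 → Prime r → r ≡ 3
  prime-divisor-of-3 = by-divisors (λ d → prime? d →-dec d ≟ 3) 3

  -- For q = 3 we have 9 ∤ R = 3, so m ≤ 2·3.
  search₂[3] : ∀ m b → m ≤ 6 → m * (m + 3) ≡ 2 * 3 ^ b → m ≡ 3 × b ≡ 2 ⊎ m ≡ 6 × b ≡ 3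
  search₂[3] = search red₂ (λ m b → m ≟ 3 ×-dec b ≟ 2 ⊎-dec m ≟ 6 ×-dec b ≟ 3) 6 5 (from-yes (1 <? 3))

Solutions₂ : ℕ → ℕ → ℕ → ℕ → Set
Solutions₂ p q a b = Is p q a b 2 5 2 1 ⊎ Is p q a b 3 2 1 1 ⊎ Is p q a b 2 3 3 3 ⊎ Is p q a b 5 3 1 2

-- q ∤ 3:  m = 1 gives (p^a, q^b) = (3, 2);  m = 2 gives (4, 5).
-- q = 3:  m = 3 gives (5, 3^2);  m = 6 gives (8, 3^3).
reduced-solutions₂ : ∀ {p q a b} → Prime p → Prime q → ∀ m → p ^ a ≡ 2 + m →
  m * (m + 3) ≡ 2 * q ^ b → Solutions₂ p q a b
reduced-solutions₂ {q = q} {b = b} pp qp m pᵃ≡ eq with q ∣? 3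
... | no q∤3 with divisors-of-2 (cofactor-divides-K red₂ m b qp eq q∤3)
...   | inj₁ refl = inj₂ (inj₁ (settle pp qp pᵃ≡ (*-cancelˡ-≡ _ 2 2 (sym eq))))
...   | inj₂ refl = inj₁ (settle pp qp pᵃ≡ (*-cancelˡ-≡ _ 5 2 (sym eq)))
reduced-solutions₂ {q = q} {b = b} pp qp m pᵃ≡ eq | yes q∣3 with prime-divisor-of-3 q∣3 qp
... | refl with search₂[3] m b (cofactor-bound red₂ m b qp 1 eq) eq
...   | inj₁ (refl , refl) = inj₂ (inj₂ (inj₂ (settle pp qp pᵃ≡ refl)))
...   | inj₂ (refl , refl) = inj₂ (inj₂ (inj₁ (settle pp qp pᵃ≡ refl)))

solutions₂ : ∀ {p q a b} → IsSolution 2 1 p q a b → Solutions₂ p q a b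
solutions₂ sol@(pp , qp , _) =
  let m , pᵃ≡ , eq = reduced-equation red₂ sol in reduced-solutions₂ pp qp m pᵃ≡ eq

opaque
  divisors-of-6 : ∀ {d} → d ∣ 6 → d ≡ 1 ⊎ d ≡ 2 ⊎ d ≡ 3 ⊎ d ≡ 6
  divisors-of-6 = by-divisors (λ d → d ≟ 1 ⊎-dec d ≟ 2 ⊎-dec d ≟ 3 ⊎-dec d ≟ 6) 6

  prime-divisor-of-11 : ∀ {r} → r ∣ 11 → Prime r → r ≡ 11
  prime-divisor-of-11 = by-divisors (λ d → prime? d →-dec d ≟ 11) 11

  -- For q = 11 we have 121 ∤ R = 11, so m ≤ 6·11; there is no solution.
  search₃[11] : ∀ m b → m ≤ 66 → m * (m * m + 6 * m + 11) ≡ 6 * 11 ^ b → ⊥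
  search₃[11] = search red₃ (λ _ _ → no λ ()) 66 6 (from-yes (1 <? 11))

Solutions₃ : ℕ → ℕ → ℕ → ℕ → Set
Solutions₃ p q a b = Is p q a b 2 3 2 1 ⊎ Is p q a b 3 83 2 1 ⊎ Is p q a b 5 3 1 2

-- q ∤ 11:  m = 1, 2, 6 give (p^a, q^b) = (4, 3), (5, 9), (9, 83), while
-- m = 3 gives p^a = 6, not a prime power.  q = 11 is impossible.
reduced-solutions₃ : ∀ {p q a b} → Prime p → Prime q → ∀ m → p ^ a ≡ 3 + m →
  m * (m * m + 6 * m + 11) ≡ 6 * q ^ b → Solutions₃ p q a b
reduced-solutions₃ {q = q} {a = a} {b = b} pp qp m pᵃ≡ eq with q ∣? 11
... | no q∤11 with divisors-of-6 (cofactor-divides-K red₃ m b qp eq q∤11)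
...   | inj₁ refl = inj₁ (settle pp qp pᵃ≡ (*-cancelˡ-≡ _ 3 6 (sym eq)))
...   | inj₂ (inj₁ refl) = inj₂ (inj₂ (settle pp qp pᵃ≡ (*-cancelˡ-≡ _ 9 6 (sym eq))))
...   | inj₂ (inj₂ (inj₁ refl)) = ⊥-elim (not-primePower pp a pᵃ≡ 2 3)
...   | inj₂ (inj₂ (inj₂ refl)) = inj₂ (inj₁ (settle pp qp pᵃ≡ (*-cancelˡ-≡ _ 83 6 (sym eq))))
reduced-solutions₃ {q = q} {a = a} {b = b} pp qp m pᵃ≡ eq | yes q∣11 with prime-divisor-of-11 q∣11 qp
... | refl = ⊥-elim (search₃[11] m b (cofactor-bound red₃ m b qp 1 eq) eq)

solutions₃ : ∀ {p q a b} → IsSolution 3 1 p q a b → Solutions₃ p q a b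
solutions₃ sol@(pp , qp , _) =
  let m , pᵃ≡ , eq = reduced-equation red₃ sol in reduced-solutions₃ pp qp m pᵃ≡ eq

opaque
  divisors-of-24 : ∀ {d} → d ∣ 24 →
    d ≡ 1 ⊎ d ≡ 2 ⊎ d ≡ 3 ⊎ d ≡ 4 ⊎ d ≡ 6 ⊎ d ≡ 8 ⊎ d ≡ 12 ⊎ d ≡ 24
  divisors-of-24 = by-divisors
    (λ d → d ≟ 1 ⊎-dec d ≟ 2 ⊎-dec d ≟ 3 ⊎-dec d ≟ 4 ⊎-dec d ≟ 6 ⊎-dec d ≟ 8 ⊎-dec d ≟ 12 ⊎-dec d ≟ 24) 24

  prime-divisor-of-50 : ∀ {r} → r ∣ 50 → Prime r → r ≡ 2 ⊎ r ≡ 5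
  prime-divisor-of-50 = by-divisors (λ d → prime? d →-dec (d ≟ 2 ⊎-dec d ≟ 5)) 50

  -- For q = 2 we have 4 ∤ R = 50, so m ≤ 24·2.
  search₄[2] : ∀ m b → m ≤ 48 →
    m * (m * m * m + 10 * (m * m) + 35 * m + 50) ≡ 24 * 2 ^ b → m ≡ 1 × b ≡ 2
  search₄[2] = search red₄ (λ m b → m ≟ 1 ×-dec b ≟ 2) 48 23 (from-yes (1 <? 2))

  -- For q = 5 we have 125 ∤ R = 50, so m ≤ 24·5².
  search₄[5] : ∀ m b → m ≤ 600 →
    m * (m * m * m + 10 * (m * m) + 35 * m + 50) ≡ 24 * 5 ^ b → m ≡ 5 × b ≡ 3
  search₄[5] = search red₄ (λ m b → m ≟ 5 ×-dec b ≟ 3) 600 17 (from-yes (1 <? 5))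

Solutions₄ : ℕ → ℕ → ℕ → ℕ → Set
Solutions₄ p q a b = Is p q a b 5 2 1 2 ⊎ Is p q a b 3 5 2 3

-- q ∤ 50:  m = 1 gives (p^a, q^b) = (5, 4); for the other divisors m of 24,
-- p^a ∈ {6, 10, 12, 28} or q^b ∈ {34, 69, 1819} is not a prime power.
-- q = 2:  m = 1 gives (5, 2^2).   q = 5:  m = 5 gives (9, 5^3).
reduced-solutions₄ : ∀ {p q a b} → Prime p → Prime q → ∀ m → p ^ a ≡ 4 + m →
  m * (m * m * m + 10 * (m * m) + 35 * m + 50) ≡ 24 * q ^ b → Solutions₄ p q a b
reduced-solutions₄ {q = q} {a = a} {b = b} pp qp m pᵃ≡ eq with q ∣? 50
... | no q∤50 with divisors-of-24 (cofactor-divides-K red₄ m b qp eq q∤50)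
...   | inj₁ refl = inj₁ (settle pp qp pᵃ≡ (*-cancelˡ-≡ _ 4 24 (sym eq)))
...   | inj₂ (inj₁ refl) = ⊥-elim (not-primePower pp a pᵃ≡ 2 3)
...   | inj₂ (inj₂ (inj₁ refl)) = ⊥-elim (not-primePower qp b (*-cancelˡ-≡ _ 34 24 (sym eq)) 2 17)
...   | inj₂ (inj₂ (inj₂ (inj₁ refl))) = ⊥-elim (not-primePower qp b (*-cancelˡ-≡ _ 69 24 (sym eq)) 3 23)
...   | inj₂ (inj₂ (inj₂ (inj₂ (inj₁ refl)))) = ⊥-elim (not-primePower pp a pᵃ≡ 2 5)
...   | inj₂ (inj₂ (inj₂ (inj₂ (inj₂ (inj₁ refl))))) = ⊥-elim (not-primePower pp a pᵃ≡ 2 3)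
...   | inj₂ (inj₂ (inj₂ (inj₂ (inj₂ (inj₂ (inj₁ refl)))))) =
        ⊥-elim (not-primePower qp b (*-cancelˡ-≡ _ 1819 24 (sym eq)) 17 107)
...   | inj₂ (inj₂ (inj₂ (inj₂ (inj₂ (inj₂ (inj₂ refl)))))) = ⊥-elim (not-primePower pp a pᵃ≡ 2 7)
reduced-solutions₄ {q = q} {a = a} {b = b} pp qp m pᵃ≡ eq | yes q∣50 with prime-divisor-of-50 q∣50 qp
... | inj₁ refl with search₄[2] m b (cofactor-bound red₄ m b qp 1 eq) eq
...   | refl , refl = inj₁ (settle pp qp pᵃ≡ refl)
reduced-solutions₄ {q = q} {a = a} {b = b} pp qp m pᵃ≡ eq | yes q∣50 | inj₂ refl
  with search₄[5] m b (cofactor-bound red₄ m b qp 2 eq) eq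
... | refl , refl = inj₂ (settle pp qp pᵃ≡ refl)

solutions₄ : ∀ {p q a b} → IsSolution 4 1 p q a b → Solutions₄ p q a b
solutions₄ sol@(pp , qp , _) =
  let m , pᵃ≡ , eq = reduced-equation red₄ sol in reduced-solutions₄ pp qp m pᵃ≡ eq

solution? : ∀ i j p q a b → Dec (IsSolution i j p q a b)
solution? i j p q a b =
  prime? p ×-dec prime? q ×-dec 1 ≤? a ×-dec 1 ≤? b ×-dec i ≤? p ^ a ×-dec j ≤? q ^ b ×-dec
  (p ^ a) C i ≟ 1 + (q ^ b) C j

verified : ∀ {i j p q a b} → {True (solution? i j p q a b)} → IsSolution i j p q a b
verified {i} {j} {p} {q} {a} {b} {is-solution} = toWitness is-solution

converse₂ : ∀ {p q a b} → Solutions₂ p q a b → IsSolution 2 1 p q a b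
converse₂ (inj₁ (refl , refl , refl , refl)) = verified
converse₂ (inj₂ (inj₁ (refl , refl , refl , refl))) = verified
converse₂ (inj₂ (inj₂ (inj₁ (refl , refl , refl , refl)))) = verified
converse₂ (inj₂ (inj₂ (inj₂ (refl , refl , refl , refl)))) = verified

converse₃ : ∀ {p q a b} → Solutions₃ p q a b → IsSolution 3 1 p q a b
converse₃ (inj₁ (refl , refl , refl , refl)) = verified
converse₃ (inj₂ (inj₁ (refl , refl , refl , refl))) = verified
converse₃ (inj₂ (inj₂ (refl , refl , refl , refl))) = verified

converse₄ : ∀ {p q a b} → Solutions₄ p q a b → IsSolution 4 1 p q a b
converse₄ (inj₁ (refl , refl , refl , refl)) = verified
converse₄ (inj₂ (refl , refl , refl , refl)) = verified

theorem1p1 : ((p q a b : ℕ) → IsSolution 2 1 p q a b ⇔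
    (Is p q a b 2 5 2 1 ⊎ Is p q a b 3 2 1 1 ⊎ Is p q a b 2 3 3 3 ⊎ Is p q a b 5 3 1 2))
    × ((p q a b : ℕ) → IsSolution 3 1 p q a b ⇔
    (Is p q a b 2 3 2 1 ⊎ Is p q a b 3 83 2 1 ⊎ Is p q a b 5 3 1 2))
    × ((p q a b : ℕ) → IsSolution 4 1 p q a b ⇔
    (Is p q a b 5 2 1 2 ⊎ Is p q a b 3 5 2 3))
theorem1p1 = (λ _ _ _ _ → mk⇔ solutions₂ converse₂)
           , (λ _ _ _ _ → mk⇔ solutions₃ converse₃)
           , (λ _ _ _ _ → mk⇔ solutions₄ converse₄)
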